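{- Let $w$ be a finite word over the positive integers and let $R_1$ be the first (top) row of $P(w)$. The following are equivalent: (a) $1w\equiv w1$; (b) every entry of $R_1$ equals $1$; (c) $\mathrm{lwi}(w)=\mathrm{lwi}(w,1)$. Furthermore, for a word $w\in\{1,2\}^n$, the following are equivalent: (d) $1w\equiv w1$; (e) $w$ is Yamanouchi.
   Context: $P(v)$ is the RSK insertion tableau of $v$ and $\equiv$ is Knuth equivalence ($v\equiv w$ iff $P(v)=P(w)$). $\mathrm{lwi}(w)$ is the length of a longest weakly increasing subsequence of $w$, and for $a$ a positive integer, $\mathrm{lwi}(w,a)$ is the length of a longest weakly increasing subsequence of $w$ whose last letter is $a$ (taken to be $0$ if $w$ contains no $a$). A word $w$ is Yamanouchi if every suffix of $w$ contains at least as many letters $i$ as letters $i+1$, for all $i\ge1$. -}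

module Defs where

open import Data.Nat using (ℕ; zero; suc; _≤_; _<ᵇ_; _≡ᵇ_; _⊔_)
open import Data.Bool using (Bool; true; false)
open import Data.Product using (_×_; _,_)
open import Data.List using (List; []; _∷_; length; foldl)

-- Words over the positive integers are lists of naturals; positivity of the
-- letters is imposed as an explicit hypothesis in the statement.
Word : Set
Word = List ℕ

-- A (semistandard) tableau as a list of rows, top (first) row first.
Tableau : Set
Tableau = List (List ℕ)

data Bumped : Set where
  none : Bumped
  out  : ℕ → Bumped

rowInsert : ℕ → List ℕ → List ℕ × Bumped
rowInsert x [] = (x ∷ []) , none
rowInsert x (y ∷ ys) with x <ᵇ y
... | true  = (x ∷ ys) , out y
... | false with rowInsert x ys
...   | (ys' , b) = (y ∷ ys') , b

insert : ℕ → Tableau → Tableau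
insert x [] = (x ∷ []) ∷ []
insert x (r ∷ rs) with rowInsert x r
... | (r' , none)  = r' ∷ rs
... | (r' , out y) = r' ∷ insert y rs

P : Word → Tableau
P w = foldl (λ T x → insert x T) [] w

-- Knuth equivalence, as in the paper: v ≡ w iff P(v) = P(w).
_≡K_ : Word → Word → Set
v ≡K w = P v ≡ P w
  where open import Relation.Binary.PropositionalEquality using (_≡_)

firstRow : Tableau → List ℕ
firstRow []      = []
firstRow (r ∷ _) = r


subsequences : Word → List Word
subsequences [] = [] ∷ []
subsequences (x ∷ w) = go (subsequences w)
  where
  go : List Word → List Word
  go [] = []
  go (s ∷ ss) = s ∷ (x ∷ s) ∷ go ss

wiFrom : ℕ → Word → Bool
wiFrom x [] = true
wiFrom x (y ∷ s) with y <ᵇ x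
... | true  = false
... | false = wiFrom y s

weaklyIncreasingᵇ : Word → Bool
weaklyIncreasingᵇ [] = true
weaklyIncreasingᵇ (x ∷ s) = wiFrom x s

lastIsᵇ : ℕ → Word → Bool
lastIsᵇ a [] = false
lastIsᵇ a (x ∷ []) = x ≡ᵇ a
lastIsᵇ a (x ∷ y ∷ s) = lastIsᵇ a (y ∷ s)

maxLenWith : (Word → Bool) → List Word → ℕ
maxLenWith p [] = 0
maxLenWith p (s ∷ ss) with p s
... | true  = length s ⊔ maxLenWith p ss
... | false = maxLenWith p ss

lwi : Word → ℕ
lwi w = maxLenWith weaklyIncreasingᵇ (subsequences w)

-- lwi(w,a): length of a longest weakly increasing subsequence of w whose last
-- letter is a (0 if there is none, in particular if w contains no a).
lwiEnd : Word → ℕ → ℕ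
lwiEnd w a = maxLenWith (λ s → weaklyIncreasingᵇ s ∧' lastIsᵇ a s) (subsequences w)
  where
  _∧'_ : Bool → Bool → Bool
  true ∧' b = b
  false ∧' _ = false

occ : ℕ → Word → ℕ
occ i [] = 0
occ i (x ∷ w) with x ≡ᵇ i
... | true  = suc (occ i w)
... | false = occ i w

data Suffix : Word → Word → Set where
  here  : ∀ {w} → Suffix w w
  there : ∀ {u w} x → Suffix u w → Suffix u (x ∷ w)

Yamanouchi : Word → Set
Yamanouchi w = ∀ u → Suffix u w → ∀ i → 1 ≤ i → occ (suc i) u ≤ occ i u

{-# OPTIONS --safe #-}

-- By Schensted's theorem, applied to the letters ≤ a, the number of entries ≤ a in the first
-- row R of P(w) is the length of a longest weakly increasing subsequence of w with letters ≤ a.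
-- As all letters are ≥ 1, P(1w) is P(w) with a 1 prepended to R, whereas P(w1) inserts 1 into
-- R; the two agree iff R consists of 1s, i.e. iff all of R is ≤ 1, i.e. iff lwi(w) = lwi(w,1).
-- Over {1, 2}, lwi(w,1) is the number of 1s, and a weakly increasing subsequence is a run of
-- 1s from a prefix followed by 2s from the complementary suffix; so lwi(w) = lwi(w,1) iff no
-- suffix has more 2s than 1s.

module Submission where

open import Defs
open import Data.Bool using (Bool; true; false; T; _∧_)
open import Data.Bool.Properties using (T-∧)
open import Data.List using (List; []; _∷_; _++_; [_]; length; foldl; replicate; concatMap)
open import Data.List.Extrema.Nat using (max; xs≤max)
open import Data.List.Membership.Propositional using (_∈_; find)
open import Data.List.Membership.Propositional.Properties using (∈-concatMap⁺; ∈-concatMap⁻)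
open import Data.List.Properties using (∷-injective; foldl-∷ʳ; length-++; length-replicate)
open import Data.List.Relation.Binary.Sublist.Propositional
  using (_⊆_; []; _∷_; _∷ʳ_; ⊆-refl)
open import Data.List.Relation.Binary.Sublist.Propositional.Properties
  using (All-resp-⊆; length-mono-≤; ++⁺; ++⁺ʳ)
open import Data.List.Relation.Unary.All as All using (All; []; _∷_)
open import Data.List.Relation.Unary.All.Properties using (∷ʳ⁺; ∷ʳ⁻; replicate⁺)
open import Data.List.Relation.Unary.Any as Any using (here; there)
open import Data.List.Relation.Unary.Linked as Linked using ([]; [-]; _∷_)
open import Data.List.Relation.Unary.Linked.Properties using (Linked⇒All)
open import Data.List.Reverse using (Reverse; []; _∶_∶ʳ_; reverseView)
open import Data.Nat using (ℕ; suc; _≤_; _<_; _<ᵇ_; _≡ᵇ_; _⊔_; z≤n; s≤s; _≤?_)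
open import Data.Nat.Properties
  using (≤-refl; ≤-trans; ≤-antisym; ≤-reflexive; ≤-pred; ≤-totalOrder; n≤1+n;
         m≤n⇒m≤1+n; <⇒≤; <⇒≱; ≮⇒≥; ≰⇒>; <-≤-trans; <-trans; 1+n≢n; m≤m⊔n; m≤n⊔m;
         ⊔-lub; +-comm; suc-injective; <ᵇ-reflects-<; ≡ᵇ⇒≡; ≡⇒≡ᵇ; module ≤-Reasoning)
open import Data.List.Relation.Unary.Sorted.TotalOrder ≤-totalOrder using (Sorted)
open import Data.Product using (_×_; _,_; proj₁; proj₂; ∃-syntax)
open import Data.Sum using (_⊎_; inj₁; inj₂)
import Data.Sum as Sum
open import Data.Unit using (tt)
open import Function using (_∘_)
open import Function.Bundles using (_⇔_; mk⇔; Equivalence)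
import Function.Properties.Equivalence as ⇔
open import Level using (0ℓ)
open import Relation.Binary.PropositionalEquality using (_≡_; refl; sym; trans; cong; subst)
import Relation.Binary.Reasoning.Setoid as SetoidReasoning
open import Relation.Nullary using (yes; no; contradiction)
open import Relation.Nullary.Reflects using (ofʸ; ofⁿ)

private
  variable
    a i x n : ℕ
    s u w : Word
    R : List ℕ

sorted-∷ : All (x ≤_) s → Sorted s → Sorted (x ∷ s)
sorted-∷ {s = []}    _           _      = [-]
sorted-∷ {s = _ ∷ _} (x≤y ∷ _) sorted = x≤y ∷ sorted

sorted⇒head≤ : Sorted (x ∷ s) → All (x ≤_) s
sorted⇒head≤ = All.tail ∘ Linked⇒All ≤-trans ≤-refl

constant-sorted : All (_≡ i) s → Sorted s
constant-sorted []                  = []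
constant-sorted (refl ∷ [])         = [-]
constant-sorted (refl ∷ refl ∷ eqs) = ≤-refl ∷ constant-sorted (refl ∷ eqs)

sorted-∷ʳ⁺ : Sorted s → All (_≤ x) s → Sorted (s ++ [ x ])
sorted-∷ʳ⁺ []              []          = [-]
sorted-∷ʳ⁺ [-]             (y≤x ∷ []) = y≤x ∷ [-]
sorted-∷ʳ⁺ (y≤z ∷ sorted) (_ ∷ s≤x)  = y≤z ∷ sorted-∷ʳ⁺ sorted s≤x

sorted-∷ʳ⁻ : ∀ s → Sorted (s ++ [ x ]) → Sorted s × All (_≤ x) s
sorted-∷ʳ⁻ []          _                = [] , []
sorted-∷ʳ⁻ (y ∷ [])    (y≤x ∷ _)        = [-] , y≤x ∷ []
sorted-∷ʳ⁻ (y ∷ z ∷ s) (y≤z ∷ sorted) with sorted-∷ʳ⁻ (z ∷ s) sorted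
... | sorted′ , z≤x ∷ s≤x = y≤z ∷ sorted′ , ≤-trans y≤z z≤x ∷ z≤x ∷ s≤x

length-∷ʳ : ∀ (s : Word) x → length (s ++ [ x ]) ≡ suc (length s)
length-∷ʳ s x = trans (length-++ s) (+-comm (length s) 1)

⊆-∷ʳ⁻ : ∀ u → s ⊆ u ++ [ x ] → s ⊆ u ⊎ ∃[ s′ ] s ≡ s′ ++ [ x ] × s′ ⊆ u
⊆-∷ʳ⁻ []      (_ ∷ʳ [])   = inj₁ []
⊆-∷ʳ⁻ []      (refl ∷ []) = inj₂ ([] , refl , [])
⊆-∷ʳ⁻ (y ∷ u) (.y ∷ʳ p)   = Sum.map (y ∷ʳ_) (λ (s′ , eq , q) → s′ , eq , y ∷ʳ q) (⊆-∷ʳ⁻ u p)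
⊆-∷ʳ⁻ (y ∷ u) (refl ∷ p)  =
  Sum.map (refl ∷_) (λ (s′ , eq , q) → y ∷ s′ , cong (y ∷_) eq , refl ∷ q) (⊆-∷ʳ⁻ u p)

weaklyIncreasingᵇ⇒Sorted : ∀ s → T (weaklyIncreasingᵇ s) → Sorted s
weaklyIncreasingᵇ⇒Sorted []      _ = []
weaklyIncreasingᵇ⇒Sorted (x ∷ s) t = wiFrom⇒Sorted x s t
  where
  wiFrom⇒Sorted : ∀ x s → T (wiFrom x s) → Sorted (x ∷ s)
  wiFrom⇒Sorted x []      _ = [-]
  wiFrom⇒Sorted x (y ∷ s) t with y <ᵇ x | <ᵇ-reflects-< y x
  ... | false | ofⁿ y≮x = ≮⇒≥ y≮x ∷ wiFrom⇒Sorted y s t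

Sorted⇒weaklyIncreasingᵇ : ∀ {s} → Sorted s → T (weaklyIncreasingᵇ s)
Sorted⇒weaklyIncreasingᵇ {[]}    _      = tt
Sorted⇒weaklyIncreasingᵇ {_ ∷ _} sorted = Sorted⇒wiFrom sorted
  where
  Sorted⇒wiFrom : ∀ {x s} → Sorted (x ∷ s) → T (wiFrom x s)
  Sorted⇒wiFrom [-] = tt
  Sorted⇒wiFrom {x} {y ∷ s} (x≤y ∷ sorted) with y <ᵇ x | <ᵇ-reflects-< y x
  ... | true  | ofʸ y<x = contradiction x≤y (<⇒≱ y<x)
  ... | false | _       = Sorted⇒wiFrom sorted

lastIsᵇ⇒≤ : Sorted s → T (lastIsᵇ a s) → All (_≤ a) s
lastIsᵇ⇒≤ {x ∷ []}    {a} _             t = ≤-reflexive (≡ᵇ⇒≡ x a t) ∷ []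
lastIsᵇ⇒≤ {x ∷ y ∷ s}     (x≤y ∷ sorted) t with lastIsᵇ⇒≤ sorted t
... | y≤a ∷ s≤a = ≤-trans x≤y y≤a ∷ y≤a ∷ s≤a

constant-lastIsᵇ : All (_≡ a) (x ∷ s) → T (lastIsᵇ a (x ∷ s))
constant-lastIsᵇ {a} (refl ∷ [])      = ≡⇒≡ᵇ a a refl
constant-lastIsᵇ     (_ ∷ eq ∷ eqs)   = constant-lastIsᵇ (eq ∷ eqs)

≤-maxLenWith : ∀ {p} ss → s ∈ ss → T (p s) → length s ≤ maxLenWith p ss
≤-maxLenWith {p = p} (t ∷ ss) (here refl) ps with p t
... | true = m≤m⊔n _ _
≤-maxLenWith {p = p} (t ∷ ss) (there s∈ss) ps with p t
... | true  = ≤-trans (≤-maxLenWith ss s∈ss ps) (m≤n⊔m _ _)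
... | false = ≤-maxLenWith ss s∈ss ps

maxLenWith-lub : ∀ {p} ss → (∀ {s} → s ∈ ss → T (p s) → length s ≤ n) → maxLenWith p ss ≤ n
maxLenWith-lub         []       _     = z≤n
maxLenWith-lub {p = p} (t ∷ ss) bound with p t | bound (here refl)
... | true  | bound-t = ⊔-lub (bound-t tt) (maxLenWith-lub ss (bound ∘ there))
... | false | _       = maxLenWith-lub ss (bound ∘ there)

maxLenWith-cong : ∀ {p q} ss → (∀ s → p s ≡ q s) → maxLenWith p ss ≡ maxLenWith q ss
maxLenWith-cong         []       _  = refl
maxLenWith-cong {p} {q} (t ∷ ss) eq with p t | q t | eq t
... | true  | true  | refl = cong (length t ⊔_) (maxLenWith-cong ss eq)
... | false | false | refl = maxLenWith-cong ss eq

-- `subsequences` and `lwiEnd` are built from where-bound helpers, which cannot be named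
-- here; each is captured below as a metavariable solved by a `refl` proof.

skipOrKeep : ℕ → Word → List Word
skipOrKeep x s = s ∷ (x ∷ s) ∷ []

module _ (x : ℕ) {F : List Word → List Word} (F-[] : F [] ≡ [])
         (F-∷ : ∀ s ss → F (s ∷ ss) ≡ s ∷ (x ∷ s) ∷ F ss) where

  ≗-concatMap : ∀ ss → F ss ≡ concatMap (skipOrKeep x) ss
  ≗-concatMap []       = F-[]
  ≗-concatMap (s ∷ ss) = trans (F-∷ s ss) (cong (λ r → s ∷ (x ∷ s) ∷ r) (≗-concatMap ss))

subsequences-∷ : ∀ x w →
  subsequences (x ∷ w) ≡ concatMap (skipOrKeep x) (subsequences w)
subsequences-∷ x w = trans unfold (≗-concatMap x {F} refl (λ _ _ → refl) (subsequences w))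
  where
  F : List Word → List Word
  F = _
  unfold : subsequences (x ∷ w) ≡ F (subsequences w)
  unfold with subsequences w
  ... | ss = refl

lwiEnd-∧ : ∀ w a →
  lwiEnd w a ≡ maxLenWith (λ s → weaklyIncreasingᵇ s ∧ lastIsᵇ a s) (subsequences w)
lwiEnd-∧ w a = trans unfold (maxLenWith-cong (subsequences w) agree)
  where
  p : Word → Bool
  p = _
  unfold : lwiEnd w a ≡ maxLenWith p (subsequences w)
  unfold = refl
  agree : ∀ s → p s ≡ weaklyIncreasingᵇ s ∧ lastIsᵇ a s
  agree s with weaklyIncreasingᵇ s
  ... | true  = refl
  ... | false = refl

⊆⇒∈-subsequences : s ⊆ w → s ∈ subsequences w
⊆⇒∈-subsequences [] = here refl
⊆⇒∈-subsequences {w = y ∷ w} (.y ∷ʳ p) rewrite subsequences-∷ y w =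
  ∈-concatMap⁺ (skipOrKeep y) (Any.map here (⊆⇒∈-subsequences p))
⊆⇒∈-subsequences {w = y ∷ w} (refl ∷ p) rewrite subsequences-∷ y w =
  ∈-concatMap⁺ (skipOrKeep y) (Any.map (λ eq → there (here (cong (y ∷_) eq))) (⊆⇒∈-subsequences p))

∈-subsequences⇒⊆ : ∀ w → s ∈ subsequences w → s ⊆ w
∈-subsequences⇒⊆ []      (here refl) = []
∈-subsequences⇒⊆ (y ∷ w) s∈ rewrite subsequences-∷ y w with find (∈-concatMap⁻ (skipOrKeep y) s∈)
... | t , t∈ , here refl         = y ∷ʳ ∈-subsequences⇒⊆ w t∈
... | t , t∈ , there (here refl) = refl ∷ ∈-subsequences⇒⊆ w t∈

sorted⊆⇒≤lwi : s ⊆ w → Sorted s → length s ≤ lwi w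
sorted⊆⇒≤lwi {w = w} p sorted =
  ≤-maxLenWith (subsequences w) (⊆⇒∈-subsequences p) (Sorted⇒weaklyIncreasingᵇ sorted)

lwi-lub : (∀ {s} → s ⊆ w → Sorted s → length s ≤ n) → lwi w ≤ n
lwi-lub {w = w} bound = maxLenWith-lub (subsequences w) λ {s} s∈ t →
  bound (∈-subsequences⇒⊆ w s∈) (weaklyIncreasingᵇ⇒Sorted s t)

sorted⊆⇒≤lwiEnd : s ⊆ w → Sorted s → T (lastIsᵇ a s) → length s ≤ lwiEnd w a
sorted⊆⇒≤lwiEnd {w = w} {a} p sorted last rewrite lwiEnd-∧ w a =
  ≤-maxLenWith (subsequences w) (⊆⇒∈-subsequences p)
    (Equivalence.from T-∧ (Sorted⇒weaklyIncreasingᵇ sorted , last))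

lwiEnd-lub : (∀ {s} → s ⊆ w → Sorted s → T (lastIsᵇ a s) → length s ≤ n) → lwiEnd w a ≤ n
lwiEnd-lub {w = w} {a} bound rewrite lwiEnd-∧ w a = maxLenWith-lub (subsequences w) λ {s} s∈ t →
  let wi , last = Equivalence.to T-∧ t
  in bound (∈-subsequences⇒⊆ w s∈) (weaklyIncreasingᵇ⇒Sorted s wi) last

newRow : ℕ → List ℕ → List ℕ
newRow x r = proj₁ (rowInsert x r)

newRow-All : ∀ {Q : ℕ → Set} R → All Q R → Q x → All Q (newRow x R)
newRow-All         []       []         qx = qx ∷ []
newRow-All {x = x} (y ∷ ys) (qy ∷ qys) qx with x <ᵇ y
... | true  = qx ∷ qys
... | false = qy ∷ newRow-All ys qys qx

newRow-sorted : ∀ R → Sorted R → Sorted (newRow x R)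
newRow-sorted         []       _      = [-]
newRow-sorted {x = x} (y ∷ ys) sorted with x <ᵇ y | <ᵇ-reflects-< x y
... | true  | ofʸ x<y = sorted-∷ (All.map (≤-trans (<⇒≤ x<y)) (sorted⇒head≤ sorted)) (Linked.tail sorted)
... | false | ofⁿ x≮y =
  sorted-∷ (newRow-All ys (sorted⇒head≤ sorted) (≮⇒≥ x≮y)) (newRow-sorted ys (Linked.tail sorted))

count≤ : ℕ → List ℕ → ℕ
count≤ a []       = 0
count≤ a (y ∷ ys) with y ≤? a
... | yes _ = suc (count≤ a ys)
... | no  _ = count≤ a ys

count≤≤length : ∀ a R → count≤ a R ≤ length R
count≤≤length a []       = z≤n
count≤≤length a (y ∷ ys) with y ≤? a
... | yes _ = s≤s (count≤≤length a ys)
... | no  _ = m≤n⇒m≤1+n (count≤≤length a ys)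

count≤-mono : a ≤ x → ∀ R → count≤ a R ≤ count≤ x R
count≤-mono         a≤x []       = z≤n
count≤-mono {a} {x} a≤x (y ∷ ys) with y ≤? a | y ≤? x
... | yes _   | yes _   = s≤s (count≤-mono a≤x ys)
... | yes y≤a | no  y≰x = contradiction (≤-trans y≤a a≤x) y≰x
... | no  _   | yes _   = m≤n⇒m≤1+n (count≤-mono a≤x ys)
... | no  _   | no  _   = count≤-mono a≤x ys

count≤-none : All (a <_) R → count≤ a R ≡ 0
count≤-none             []           = refl
count≤-none {a} {y ∷ _} (a<y ∷ a<ys) with y ≤? a
... | yes y≤a = contradiction y≤a (<⇒≱ a<y)
... | no  _   = count≤-none a<ys

All≤⇔count≤≡length : ∀ a R → All (_≤ a) R ⇔ (count≤ a R ≡ length R)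
All≤⇔count≤≡length a R = mk⇔ (to R) (from R)
  where
  to : ∀ R → All (_≤ a) R → count≤ a R ≡ length R
  to []       []           = refl
  to (y ∷ ys) (y≤a ∷ ys≤a) with y ≤? a
  ... | yes _   = cong suc (to ys ys≤a)
  ... | no  y≰a = contradiction y≤a y≰a
  from : ∀ R → count≤ a R ≡ length R → All (_≤ a) R
  from []       _  = []
  from (y ∷ ys) eq with y ≤? a
  ... | yes y≤a = y≤a ∷ from ys (suc-injective eq)
  ... | no  _   = contradiction (≤-reflexive (sym eq)) (<⇒≱ (s≤s (count≤≤length a ys)))

count≤-newRow-≥ : ∀ R → count≤ a R ≤ count≤ a (newRow x R)
count≤-newRow-≥             []       = z≤n
count≤-newRow-≥ {a} {x} (y ∷ ys) with x <ᵇ y | <ᵇ-reflects-< x y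
... | true  | ofʸ x<y with y ≤? a | x ≤? a
...   | yes _   | yes _   = ≤-refl
...   | yes y≤a | no  x≰a = contradiction (≤-trans (<⇒≤ x<y) y≤a) x≰a
...   | no  _   | yes _   = n≤1+n _
...   | no  _   | no  _   = ≤-refl
count≤-newRow-≥ {a} {x} (y ∷ ys) | false | _ with y ≤? a
...   | yes _ = s≤s (count≤-newRow-≥ ys)
...   | no  _ = count≤-newRow-≥ ys

count≤-newRow-self : ∀ R → count≤ x (newRow x R) ≡ suc (count≤ x R)
count≤-newRow-self {x} [] with x ≤? x
... | yes _   = refl
... | no  x≰x = contradiction ≤-refl x≰x
count≤-newRow-self {x} (y ∷ ys) with x <ᵇ y | <ᵇ-reflects-< x y
... | true  | ofʸ x<y with x ≤? x | y ≤? x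
...   | yes _ | no  _   = refl
...   | no  x≰x | _     = contradiction ≤-refl x≰x
...   | _     | yes y≤x = contradiction y≤x (<⇒≱ x<y)
count≤-newRow-self {x} (y ∷ ys) | false | ofⁿ x≮y with y ≤? x
...   | yes _   = cong suc (count≤-newRow-self ys)
...   | no  y≰x = contradiction (≮⇒≥ x≮y) y≰x

count≤-newRow-< : a < x → ∀ R → count≤ a (newRow x R) ≡ count≤ a R
count≤-newRow-< {a} {x} a<x [] with x ≤? a
... | yes x≤a = contradiction x≤a (<⇒≱ a<x)
... | no  _   = refl
count≤-newRow-< {a} {x} a<x (y ∷ ys) with x <ᵇ y | <ᵇ-reflects-< x y
... | true  | ofʸ x<y with x ≤? a | y ≤? a
...   | no  _   | no  _   = refl
...   | yes x≤a | _       = contradiction x≤a (<⇒≱ a<x)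
...   | _       | yes y≤a = contradiction y≤a (<⇒≱ (<-trans a<x x<y))
count≤-newRow-< {a} {x} a<x (y ∷ ys) | false | _ with y ≤? a
...   | yes _ = cong suc (count≤-newRow-< a<x ys)
...   | no  _ = count≤-newRow-< a<x ys

-- The count of entries ≤ a grows only if no entry in (x, a] is bumped, i.e. if R has none.
count≤-newRow-≤ : ∀ R → Sorted R → x ≤ a →
  count≤ a (newRow x R) ≤ count≤ a R ⊎ count≤ a (newRow x R) ≤ suc (count≤ x R)
count≤-newRow-≤ {x} {a} [] _ _ = inj₂ (count≤≤length a (x ∷ []))
count≤-newRow-≤ {x} {a} (y ∷ ys) sorted x≤a with x <ᵇ y | <ᵇ-reflects-< x y
... | true  | ofʸ x<y with y ≤? a | x ≤? a
...   | _       | no  x≰a = contradiction x≤a x≰a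
...   | yes _   | yes _   = inj₁ ≤-refl
...   | no  y≰a | yes _   = inj₂ (s≤s (≤-trans (≤-reflexive ys-none) z≤n))
  where
  ys-none : count≤ a ys ≡ 0
  ys-none = count≤-none (All.map (<-≤-trans (≰⇒> y≰a)) (sorted⇒head≤ sorted))
count≤-newRow-≤ {x} {a} (y ∷ ys) sorted x≤a | false | ofⁿ x≮y with y ≤? a | y ≤? x
...   | yes _   | yes _   = Sum.map s≤s s≤s (count≤-newRow-≤ ys (Linked.tail sorted) x≤a)
...   | no  y≰a | _       = contradiction (≤-trans (≮⇒≥ x≮y) x≤a) y≰a
...   | _       | no  y≰x = contradiction (≮⇒≥ x≮y) y≰x

firstRow-insert : ∀ x T → firstRow (insert x T) ≡ newRow x (firstRow T)
firstRow-insert x []       = refl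
firstRow-insert x (r ∷ rs) with rowInsert x r
... | r′ , none  = refl
... | r′ , out _ = refl

firstRow-P-∷ʳ : ∀ u x → firstRow (P (u ++ [ x ])) ≡ newRow x (firstRow (P u))
firstRow-P-∷ʳ u x = trans (cong firstRow (foldl-∷ʳ _ [] x u)) (firstRow-insert x (P u))

firstRow-P-induction : (Q : Word → List ℕ → Set) → Q [] [] →
  (∀ {u R} x → Q u R → Q (u ++ [ x ]) (newRow x R)) → ∀ w → Q w (firstRow (P w))
firstRow-P-induction Q base step w = go (reverseView w)
  where
  go : ∀ {u} → Reverse u → Q u (firstRow (P u))
  go []             = base
  go (u ∶ rs ∶ʳ x) = subst (Q (u ++ [ x ])) (sym (firstRow-P-∷ʳ u x)) (step x (go rs))

firstRow-All : ∀ {Q : ℕ → Set} w → All Q w → All Q (firstRow (P w))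
firstRow-All {Q} = firstRow-P-induction (λ u R → All Q u → All Q R) (λ _ → [])
  λ {_} {R} x ih qs → let qu , qx = ∷ʳ⁻ qs in newRow-All R (ih qu) qx

LongSortedSublist : (a : ℕ) (u : Word) (n : ℕ) → Set
LongSortedSublist a u n = ∃[ s ] s ⊆ u × Sorted s × All (_≤ a) s × n ≤ length s

record LongestSorted≤ (a : ℕ) (u : Word) (n : ℕ) : Set where
  field
    bound   : ∀ {s} → s ⊆ u → Sorted s → All (_≤ a) s → length s ≤ n
    witness : LongSortedSublist a u n

open LongestSorted≤

longestSorted≤-[] : ∀ a → LongestSorted≤ a [] 0
longestSorted≤-[] a = record
  { bound   = λ p _ _ → length-mono-≤ p
  ; witness = [] , [] , [] , [] , z≤n
  }

module _ {u : Word} {R : List ℕ} {x : ℕ}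
         (sorted : Sorted R) (longest : ∀ a → LongestSorted≤ a u (count≤ a R)) where

  newRow-bound : ∀ a {s} → s ⊆ u ++ [ x ] → Sorted s → All (_≤ a) s →
                 length s ≤ count≤ a (newRow x R)
  newRow-bound a p sorted-s s≤a with ⊆-∷ʳ⁻ u p
  ... | inj₁ s⊆u = ≤-trans (bound (longest a) s⊆u sorted-s s≤a) (count≤-newRow-≥ R)
  ... | inj₂ (s , refl , s⊆u) = begin
      length (s ++ [ x ])   ≡⟨ length-∷ʳ s x ⟩
      suc (length s)        ≤⟨ s≤s (bound (longest x) s⊆u sorted′ s≤x) ⟩
      suc (count≤ x R)      ≡⟨ sym (count≤-newRow-self R) ⟩
      count≤ x (newRow x R) ≤⟨ count≤-mono (proj₂ (∷ʳ⁻ s≤a)) (newRow x R) ⟩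
      count≤ a (newRow x R) ∎
    where
    open ≤-Reasoning
    sorted′ = proj₁ (sorted-∷ʳ⁻ s sorted-s)
    s≤x     = proj₂ (sorted-∷ʳ⁻ s sorted-s)

  reuse-witness : ∀ {a} → count≤ a (newRow x R) ≤ count≤ a R →
          LongSortedSublist a (u ++ [ x ]) (count≤ a (newRow x R))
  reuse-witness {a} ≤old with witness (longest a)
  ... | s , p , sorted-s , s≤a , c≤ = s , ++⁺ʳ [ x ] p , sorted-s , s≤a , ≤-trans ≤old c≤

  newRow-witness : ∀ a → LongSortedSublist a (u ++ [ x ]) (count≤ a (newRow x R))
  newRow-witness a with x ≤? a
  ... | no x≰a = reuse-witness (≤-reflexive (count≤-newRow-< (≰⇒> x≰a) R))
  ... | yes x≤a with count≤-newRow-≤ R sorted x≤a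
  ...   | inj₁ ≤old = reuse-witness ≤old
  ...   | inj₂ ≤new with witness (longest x)
  ...     | s , p , sorted-s , s≤x , c≤ =
    s ++ [ x ] , ++⁺ p ⊆-refl , sorted-∷ʳ⁺ sorted-s s≤x ,
    ∷ʳ⁺ (All.map (λ y≤x → ≤-trans y≤x x≤a) s≤x) x≤a ,
    ≤-trans ≤new (≤-trans (s≤s c≤) (≤-reflexive (sym (length-∷ʳ s x))))

  longestSorted≤-newRow : ∀ a → LongestSorted≤ a (u ++ [ x ]) (count≤ a (newRow x R))
  longestSorted≤-newRow a = record { bound = newRow-bound a ; witness = newRow-witness a }

schensted : ∀ w → Sorted (firstRow (P w)) ×
                  (∀ a → LongestSorted≤ a w (count≤ a (firstRow (P w))))
schensted = firstRow-P-induction (λ u R → Sorted R × (∀ a → LongestSorted≤ a u (count≤ a R)))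
  ([] , longestSorted≤-[])
  λ {_} {R} x (sorted , longest) → newRow-sorted R sorted , longestSorted≤-newRow sorted longest

longSortedSublist⇒≤lwi : LongSortedSublist a w n → n ≤ lwi w
longSortedSublist⇒≤lwi (_ , p , sorted , _ , n≤) = ≤-trans n≤ (sorted⊆⇒≤lwi p sorted)

lwi≡longestSorted≤ : All (_≤ a) w → LongestSorted≤ a w n → lwi w ≡ n
lwi≡longestSorted≤ w≤a longest = ≤-antisym
  (lwi-lub λ p sorted → bound longest p sorted (All-resp-⊆ p w≤a))
  (longSortedSublist⇒≤lwi (witness longest))

ones⇔≤1 : All (1 ≤_) s → All (_≡ 1) s ⇔ All (_≤ 1) s
ones⇔≤1 pos = mk⇔ (All.map ≤-reflexive)
  λ s≤1 → All.zipWith (λ (1≤y , y≤1) → ≤-antisym y≤1 1≤y) (pos , s≤1)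

longSortedSublist≤1⇒≤lwiEnd : All (1 ≤_) w → LongSortedSublist 1 w n → n ≤ lwiEnd w 1
longSortedSublist≤1⇒≤lwiEnd _   ([]    , _ , _      , _   , n≤) = ≤-trans n≤ z≤n
longSortedSublist≤1⇒≤lwiEnd pos (_ ∷ _ , p , sorted , s≤1 , n≤) = ≤-trans n≤
  (sorted⊆⇒≤lwiEnd p sorted (constant-lastIsᵇ (Equivalence.from (ones⇔≤1 (All-resp-⊆ p pos)) s≤1)))

lwiEnd1≡longestSorted≤1 : All (1 ≤_) w → LongestSorted≤ 1 w n → lwiEnd w 1 ≡ n
lwiEnd1≡longestSorted≤1 pos longest = ≤-antisym
  (lwiEnd-lub λ p sorted last → bound longest p sorted (lastIsᵇ⇒≤ sorted last))
  (longSortedSublist≤1⇒≤lwiEnd pos (witness longest))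

lwi≡length-firstRow : ∀ w → lwi w ≡ length (firstRow (P w))
lwi≡length-firstRow w = lwi≡longestSorted≤ w≤m
  (subst (LongestSorted≤ m w) (Equivalence.to (All≤⇔count≤≡length m _) (firstRow-All w w≤m))
    (proj₂ (schensted w) m))
  where
  m   = max 0 w
  w≤m = xs≤max 0 w

lwiEnd1≡count≤1-firstRow : ∀ w → All (1 ≤_) w → lwiEnd w 1 ≡ count≤ 1 (firstRow (P w))
lwiEnd1≡count≤1-firstRow w pos = lwiEnd1≡longestSorted≤1 pos (proj₂ (schensted w) 1)

firstRowOnes⇔lwi≡lwiEnd : ∀ w → All (1 ≤_) w →
                          All (_≡ 1) (firstRow (P w)) ⇔ (lwi w ≡ lwiEnd w 1)
firstRowOnes⇔lwi≡lwiEnd w pos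
  rewrite lwi≡length-firstRow w | lwiEnd1≡count≤1-firstRow w pos =
  ⇔.trans (ones⇔≤1 (firstRow-All w pos)) (⇔.trans (All≤⇔count≤≡length 1 _) (mk⇔ sym sym))

insertAll : Tableau → Word → Tableau
insertAll = foldl (λ T x → insert x T)

prependOne : Tableau → Tableau
prependOne []       = (1 ∷ []) ∷ []
prependOne (r ∷ rs) = (1 ∷ r) ∷ rs

insert-prependOne : 1 ≤ x → ∀ T → insert x (prependOne T) ≡ prependOne (insert x T)
insert-prependOne {suc x} _ []       = refl
insert-prependOne {suc x} _ (r ∷ rs) with rowInsert (suc x) r
... | _ , none  = refl
... | _ , out _ = refl

insertAll-prependOne : ∀ T {w} → All (1 ≤_) w →
                       insertAll (prependOne T) w ≡ prependOne (insertAll T w)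
insertAll-prependOne T {[]}    []          = refl
insertAll-prependOne T {x ∷ w} (1≤x ∷ pos) =
  trans (cong (λ T′ → insertAll T′ w) (insert-prependOne 1≤x T))
        (insertAll-prependOne (insert x T) pos)

rowInsert-1-ones : All (_≡ 1) R → rowInsert 1 R ≡ (1 ∷ R , none)
rowInsert-1-ones []            = refl
rowInsert-1-ones (refl ∷ ones) rewrite rowInsert-1-ones ones = refl

newRow-1-prepends⇒ones : ∀ R → 1 ∷ R ≡ newRow 1 R → All (_≡ 1) R
newRow-1-prepends⇒ones []       _  = []
newRow-1-prepends⇒ones (y ∷ ys) eq with 1 <ᵇ y
... | true  = contradiction (suc-injective (cong length eq)) 1+n≢n
... | false with ∷-injective eq
...   | refl , eq′ = refl ∷ newRow-1-prepends⇒ones ys eq′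

ones⇒prependOne≡insert1 : ∀ T → All (_≡ 1) (firstRow T) → prependOne T ≡ insert 1 T
ones⇒prependOne≡insert1 []       _    = refl
ones⇒prependOne≡insert1 (r ∷ rs) ones rewrite rowInsert-1-ones ones = refl

prependOne≡insert1⇒ones : ∀ T → prependOne T ≡ insert 1 T → All (_≡ 1) (firstRow T)
prependOne≡insert1⇒ones []       _  = []
prependOne≡insert1⇒ones (r ∷ rs) eq =
  newRow-1-prepends⇒ones r (trans (cong firstRow eq) (firstRow-insert 1 (r ∷ rs)))

knuth⇔firstRowOnes : ∀ w → All (1 ≤_) w →
                     ((1 ∷ w) ≡K (w ++ [ 1 ])) ⇔ All (_≡ 1) (firstRow (P w))
knuth⇔firstRowOnes w pos
  rewrite insertAll-prependOne [] pos | foldl-∷ʳ (λ T x → insert x T) [] 1 w =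
  mk⇔ (prependOne≡insert1⇒ones (P w)) (ones⇒prependOne≡insert1 (P w))

OneOrTwo : ℕ → Set
OneOrTwo a = a ≡ 1 ⊎ a ≡ 2

OneOrTwo⇒1≤ : OneOrTwo a → 1 ≤ a
OneOrTwo⇒1≤ (inj₁ refl) = s≤s z≤n
OneOrTwo⇒1≤ (inj₂ refl) = s≤s z≤n

Balanced : Word → Set
Balanced w = ∀ {v} → Suffix v w → occ 2 v ≤ occ 1 v

occ≤occ-∷ : ∀ i x w → occ i w ≤ occ i (x ∷ w)
occ≤occ-∷ i x w with x ≡ᵇ i
... | true  = n≤1+n _
... | false = ≤-refl

occ-∷-self : ∀ i w → occ i (i ∷ w) ≡ suc (occ i w)
occ-∷-self i w with i ≡ᵇ i | ≡⇒≡ᵇ i i refl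
... | true | _ = refl

occ-≥3 : ∀ j → All OneOrTwo u → occ (suc (suc (suc j))) u ≡ 0
occ-≥3 j []               = refl
occ-≥3 j (inj₁ refl ∷ ot) = occ-≥3 j ot
occ-≥3 j (inj₂ refl ∷ ot) = occ-≥3 j ot

constant-⊆⇒≤occ : s ⊆ w → All (_≡ i) s → length s ≤ occ i w
constant-⊆⇒≤occ             []         _            = z≤n
constant-⊆⇒≤occ             (y ∷ʳ p)   eqs          = ≤-trans (constant-⊆⇒≤occ p eqs) (occ≤occ-∷ _ y _)
constant-⊆⇒≤occ {w = _ ∷ w} (refl ∷ p) (refl ∷ eqs) =
  ≤-trans (s≤s (constant-⊆⇒≤occ p eqs)) (≤-reflexive (sym (occ-∷-self _ w)))

replicate-occ-⊆ : ∀ i w → replicate (occ i w) i ⊆ w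
replicate-occ-⊆ i []      = []
replicate-occ-⊆ i (x ∷ w) with x ≡ᵇ i | ≡ᵇ⇒≡ x i
... | true  | x≡i = sym (x≡i tt) ∷ replicate-occ-⊆ i w
... | false | _   = x ∷ʳ replicate-occ-⊆ i w

longSortedSublist-occ : ∀ i w → LongSortedSublist i w (occ i w)
longSortedSublist-occ i w =
  replicate (occ i w) i , replicate-occ-⊆ i w , constant-sorted (replicate⁺ _ refl) ,
  replicate⁺ _ ≤-refl , ≤-reflexive (sym (length-replicate _))

longestSorted≤1-occ : All (1 ≤_) w → LongestSorted≤ 1 w (occ 1 w)
longestSorted≤1-occ {w} pos = record
  { bound   = λ p _ s≤1 → constant-⊆⇒≤occ p (Equivalence.from (ones⇔≤1 (All-resp-⊆ p pos)) s≤1)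
  ; witness = longSortedSublist-occ 1 w
  }

lwi≡lwiEnd⇔lwi≤occ1 : ∀ w → All (1 ≤_) w → (lwi w ≡ lwiEnd w 1) ⇔ (lwi w ≤ occ 1 w)
lwi≡lwiEnd⇔lwi≤occ1 w pos rewrite lwiEnd1≡longestSorted≤1 pos (longestSorted≤1-occ pos) =
  mk⇔ ≤-reflexive λ lwi≤ → ≤-antisym lwi≤ (longSortedSublist⇒≤lwi (longSortedSublist-occ 1 w))

Balanced⇒sorted-bound : All OneOrTwo w → Balanced w → s ⊆ w → Sorted s → length s ≤ occ 1 w
Balanced⇒sorted-bound _                _   []         _      = z≤n
Balanced⇒sorted-bound (_ ∷ ot)         bal (y ∷ʳ p)   sorted =
  ≤-trans (Balanced⇒sorted-bound ot (λ sfx → bal (there y sfx)) p sorted) (occ≤occ-∷ 1 y _)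
Balanced⇒sorted-bound (inj₁ refl ∷ ot) bal (refl ∷ p) sorted =
  s≤s (Balanced⇒sorted-bound ot (λ sfx → bal (there 1 sfx)) p (Linked.tail sorted))
Balanced⇒sorted-bound (inj₂ refl ∷ ot) bal (refl ∷ p) sorted =
  ≤-trans (constant-⊆⇒≤occ (refl ∷ p) (refl ∷ twos)) (bal here)
  where
  twos = All.zipWith (λ { (2≤y , inj₂ y≡2) → y≡2 ; (s≤s () , inj₁ refl) })
                     (sorted⇒head≤ sorted , All-resp-⊆ p ot)

sorted-bound⇒Balanced : ∀ w → All OneOrTwo w →
  (∀ {s} → s ⊆ w → Sorted s → length s ≤ occ 1 w) → Balanced w
sorted-bound⇒Balanced w _ bound here with longSortedSublist-occ 2 w
... | _ , p , sorted , _ , occ2≤ = ≤-trans occ2≤ (bound p sorted)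
sorted-bound⇒Balanced (.1 ∷ w) (inj₁ refl ∷ ot) bound (there _ sfx) =
  sorted-bound⇒Balanced w ot
    (λ p sorted →
      ≤-pred (bound (refl ∷ p) (sorted-∷ (All.map OneOrTwo⇒1≤ (All-resp-⊆ p ot)) sorted)))
    sfx
sorted-bound⇒Balanced (.2 ∷ w) (inj₂ refl ∷ ot) bound (there _ sfx) =
  sorted-bound⇒Balanced w ot (λ p → bound (2 ∷ʳ p)) sfx

Balanced⇔lwi≤occ1 : ∀ w → All OneOrTwo w → Balanced w ⇔ (lwi w ≤ occ 1 w)
Balanced⇔lwi≤occ1 w ot = mk⇔ to from
  where
  to : Balanced w → lwi w ≤ occ 1 w
  to bal = lwi-lub (Balanced⇒sorted-bound ot bal)
  from : lwi w ≤ occ 1 w → Balanced w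
  from lwi≤ = sorted-bound⇒Balanced w ot λ p sorted → ≤-trans (sorted⊆⇒≤lwi p sorted) lwi≤

suffix-All : ∀ {Q : ℕ → Set} {v} → Suffix v w → All Q w → All Q v
suffix-All here          qs       = qs
suffix-All (there _ sfx) (_ ∷ qs) = suffix-All sfx qs

Yamanouchi⇔Balanced : ∀ w → All OneOrTwo w → Yamanouchi w ⇔ Balanced w
Yamanouchi⇔Balanced w ot = mk⇔ balanced yamanouchi
  where
  balanced : Yamanouchi w → Balanced w
  balanced yam sfx = yam _ sfx 1 ≤-refl
  yamanouchi : Balanced w → Yamanouchi w
  yamanouchi bal v sfx 1             _ = bal sfx
  yamanouchi bal v sfx (suc (suc j)) _ = ≤-trans (≤-reflexive (occ-≥3 j (suffix-All sfx ot))) z≤n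

corollary3p3 :
    (∀ (w : Word) → All (λ a → 1 ≤ a) w →
      (((1 ∷ w) ≡K (w ++ (1 ∷ []))) ⇔ All (λ a → a ≡ 1) (firstRow (P w)))
      × (All (λ a → a ≡ 1) (firstRow (P w)) ⇔ (lwi w ≡ lwiEnd w 1)))
    × (∀ (n : ℕ) (w : Word) → length w ≡ n → All (λ a → (a ≡ 1) ⊎ (a ≡ 2)) w →
      (((1 ∷ w) ≡K (w ++ (1 ∷ []))) ⇔ Yamanouchi w))
corollary3p3 =
  (λ w pos → knuth⇔firstRowOnes w pos , firstRowOnes⇔lwi≡lwiEnd w pos) , knuth⇔Yamanouchi
  where
  knuth⇔Yamanouchi : ∀ n w → length w ≡ n → All OneOrTwo w →
                     ((1 ∷ w) ≡K (w ++ [ 1 ])) ⇔ Yamanouchi w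
  knuth⇔Yamanouchi _ w _ ot = begin
    (1 ∷ w) ≡K (w ++ [ 1 ])       ≈⟨ knuth⇔firstRowOnes w pos ⟩
    All (_≡ 1) (firstRow (P w))   ≈⟨ firstRowOnes⇔lwi≡lwiEnd w pos ⟩
    lwi w ≡ lwiEnd w 1            ≈⟨ lwi≡lwiEnd⇔lwi≤occ1 w pos ⟩
    lwi w ≤ occ 1 w               ≈⟨ Balanced⇔lwi≤occ1 w ot ⟨
    Balanced w                    ≈⟨ Yamanouchi⇔Balanced w ot ⟨
    Yamanouchi w                  ∎
    where
    open SetoidReasoning (⇔.⇔-setoid 0ℓ)
    pos = All.map OneOrTwo⇒1≤ ot
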